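{- Let $\alpha=[\alpha_1,\ldots,\alpha_k]$ be a composition of $n$ with $n\le1$ or $\alpha_1>1$, and suppose the $j$-th smallest element $\alpha_1+\cdots+\alpha_j$ of $I(\alpha)$ is an internal peak of $I(\alpha)$. Then \[\theta_\alpha=\theta_{[\alpha_1,\ldots,\alpha_j-1,1,\alpha_{j+1},\ldots,\alpha_k]}+\theta_{[\alpha_1,\ldots,\alpha_j,1,\alpha_{j+1}-1,\ldots,\alpha_k]}-\theta_{[\alpha_1,\ldots,\alpha_j-1,1,1,\alpha_{j+1}-1,\ldots,\alpha_k]}.\]
   Context: A composition $\alpha=[\alpha_1,\ldots,\alpha_k]$ of $n$ ($\alpha\vDash n$) is an ordered list of positive integers summing to $n$; $k(\alpha)=k$; $I(\alpha)=\{\alpha_1,\alpha_1+\alpha_2,\ldots,\alpha_1+\cdots+\alpha_{k-1}\}\subset[n-1]$, $A+1=\{a+1:a\in A\}$. $M_\alpha=\sum_{i_1<\cdots<i_k}x_{i_1}^{\alpha_1}\cdots x_{i_k}^{\alpha_k}$. For $\alpha\vDash n$, $\theta_\alpha=\sum_{\beta\vDash n,\ I(\alpha)\subset I(\beta)\cup(I(\beta)+1)}2^{k(\beta)}M_\beta$. An internal peak of $I(\alpha)$ is an element $i\in I(\alpha)$ with $i-1\notin I(\alpha)$, $i+1\notin I(\alpha)$, and $i\in\{3,\ldots,n-2\}$ (equivalently, for the peak $\alpha_1+\cdots+\alpha_j$: $\alpha_{j+1}\ge2$, and $\alpha_j\ge2$ if $j\ne1$, $\alpha_j\ge3$ if $j=1$).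 -}

module Defs where

open import Data.Nat using (ℕ; zero; suc; _+_; _∸_; _^_; _≤_; _<_; _≟_)
open import Data.Nat.Properties using (_<?_)
open import Data.List using (List; []; _∷_; length; map)
open import Data.Nat.ListAction using (sum)
open import Data.List.Membership.DecPropositional _≟_ using (_∈_; _∉_; _∈?_)
open import Data.List.Relation.Unary.All using (All; all?)
open import Data.Integer using (ℤ; +_)
open import Data.Product using (_×_)
open import Data.Sum using (_⊎_)
open import Relation.Nullary using (Dec; does)
open import Relation.Nullary.Decidable using (_×-dec_; _⊎-dec_)
open import Relation.Binary.PropositionalEquality using (_≡_)
open import Data.Bool using (if_then_else_)

IsComposition : ℕ → List ℕ → Set
IsComposition n α = All (λ a → 0 < a) α × sum α ≡ n

isComposition? : (n : ℕ) → (α : List ℕ) → Dec (IsComposition n α)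
isComposition? n α = all? (0 <?_) α ×-dec (sum α ≟ n)

partialSums : ℕ → List ℕ → List ℕ
partialSums acc [] = []
partialSums acc (x ∷ []) = []
partialSums acc (x ∷ y ∷ r) = (acc + x) ∷ partialSums (acc + x) (y ∷ r)

I : List ℕ → List ℕ
I α = partialSums 0 α

CoverCond : List ℕ → List ℕ → Set
CoverCond A B = All (λ i → i ∈ B ⊎ i ∈ map suc B) A

coverCond? : (A B : List ℕ) → Dec (CoverCond A B)
coverCond? A B = all? (λ i → (i ∈? B) ⊎-dec (i ∈? map suc B)) A

-- Quasisymmetric functions of degree n are represented by their
-- coefficients in the monomial basis M_β (β a composition).
-- thetaCoeff α β = coefficient of M_β in θ_α, where n = |α|:
--   2^{k(β)} if β ⊨ n and I(α) ⊆ I(β) ∪ (I(β)+1), and 0 otherwise.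
thetaCoeff : List ℕ → List ℕ → ℤ
thetaCoeff α β =
  if does (isComposition? (sum α) β ×-dec coverCond? (I α) (I β))
  then + (2 ^ length β) else + 0

InternalPeak : ℕ → List ℕ → ℕ → Set
InternalPeak n S i = i ∈ S × (i ∸ 1) ∉ S × suc i ∉ S × 3 ≤ i × i ≤ n ∸ 2

-- Writing p = α₁ + ⋯ + α_j, the three compositions on the right have cut sets
-- I(α) ∪ {p − 1}, I(α) ∪ {p + 1} and I(α) ∪ {p − 1, p + 1}, and the same size n.
-- Whether M_β occurs in θ_γ depends only on whether every cut of γ lies in
-- I(β) ∪ (I(β) + 1).  If p does, then so does p − 1 or p + 1 (p ∈ I(β) puts
-- p + 1 in I(β) + 1, and p ∈ I(β) + 1 puts p − 1 in I(β)), so the identity is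
-- inclusion–exclusion, coefficient by coefficient.
module Submission where

open import Defs
open import Data.Nat using (ℕ; suc; _+_; _∸_; _≤_; _<_; _^_; _≟_; s≤s; z≤n)
open import Data.Nat.Properties using (+-suc; +-assoc; +-identityʳ; +-comm)
open import Data.List using (List; []; _∷_; _++_; length; map)
open import Data.Nat.ListAction using (sum)
open import Data.Nat.ListAction.Properties using (sum-++)
open import Data.Integer using (ℤ; +_) renaming (_+_ to _+ℤ_; _-_ to _-ℤ_)
import Data.Integer.Properties as ℤ
open import Algebra.Properties.AbelianGroup ℤ.+-0-abelianGroup using (xyx⁻¹≈y)
open import Data.Bool using (Bool; true; false; _∧_; if_then_else_)
open import Data.Bool.Properties using (∧-assoc)
open import Data.Product using (_×_; ∃-syntax; _,_)
open import Data.Sum using (_⊎_; inj₁; inj₂; [_,_])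
import Data.Sum as Sum
open import Relation.Nullary using (Dec; does; yes; no)
open import Relation.Nullary.Decidable using (_⊎-dec_; dec-true)
open import Data.List.Membership.DecPropositional _≟_ using (_∈_; _∈?_)
open import Data.List.Membership.Propositional.Properties using (∈-map⁺; ∈-map⁻)
open import Data.List.Relation.Unary.All using (_∷_)
open import Data.List.Relation.Unary.All.Properties using (++⁻ʳ)
open import Relation.Binary.PropositionalEquality
  using (_≡_; refl; sym; trans; cong; cong₂; module ≡-Reasoning)

_when_ : ℤ → Bool → ℤ
k when b = if b then k else + 0

when-inclusion-exclusion : ∀ k g x y z r → (y ≡ true → x ≡ true ⊎ z ≡ true) →
  k when (g ∧ (y ∧ r)) ≡
    (k when (g ∧ (x ∧ (y ∧ r))) +ℤ k when (g ∧ (y ∧ (z ∧ r))))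
      -ℤ k when (g ∧ (x ∧ (y ∧ (z ∧ r))))
when-inclusion-exclusion k false x     y     z     r h = refl
when-inclusion-exclusion k true  false false z     r h = refl
when-inclusion-exclusion k true  true  false z     r h = refl
when-inclusion-exclusion k true  false true  false r h =
  [ (λ ()) , (λ ()) ] (h refl)
when-inclusion-exclusion k true  true  true  false r h =
  sym (trans (ℤ.+-identityʳ _) (ℤ.+-identityʳ (k when r)))
when-inclusion-exclusion k true  false true  true  r h =
  sym (trans (ℤ.+-identityʳ _) (ℤ.+-identityˡ (k when r)))
when-inclusion-exclusion k true  true  true  true  r h =
  sym (xyx⁻¹≈y (k when r) (k when r))

Covers : List ℕ → ℕ → Set
Covers B i = i ∈ B ⊎ i ∈ map suc B

covers? : ∀ B i → Dec (Covers B i)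
covers? B i = (i ∈? B) ⊎-dec (i ∈? map suc B)

covers-suc⇒covers-neighbour : ∀ {B} i →
  Covers B (suc i) → Covers B i ⊎ Covers B (suc (suc i))
covers-suc⇒covers-neighbour i (inj₁ 1+i∈B) = inj₂ (inj₂ (∈-map⁺ suc 1+i∈B))
covers-suc⇒covers-neighbour i (inj₂ 1+i∈B+1) with ∈-map⁻ suc 1+i∈B+1
... | .i , i∈B , refl = inj₁ (inj₁ i∈B)

does-true-⊎ : ∀ {p q r} {P : Set p} {Q : Set q} {R : Set r}
  (P? : Dec P) (Q? : Dec Q) (R? : Dec R) → (P → Q ⊎ R) →
  does P? ≡ true → does Q? ≡ true ⊎ does R? ≡ true
does-true-⊎ (yes p) Q? R? f _ = Sum.map (dec-true Q?) (dec-true R?) (f p)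
does-true-⊎ (no _)  Q? R? f ()

coverCond?-++ : ∀ xs ys B →
  does (coverCond? (xs ++ ys) B) ≡ does (coverCond? xs B) ∧ does (coverCond? ys B)
coverCond?-++ []       ys B = refl
coverCond?-++ (x ∷ xs) ys B =
  trans (cong (does (covers? B x) ∧_) (coverCond?-++ xs ys B))
        (sym (∧-assoc (does (covers? B x)) _ _))

-- thetaCoeff α β is definitionally thetaOn β (sum α) (I α).
thetaOn : List ℕ → ℕ → List ℕ → ℤ
thetaOn β m X =
  (+ (2 ^ length β)) when (does (isComposition? m β) ∧ does (coverCond? X (I β)))

thetaOn-++ : ∀ β m L X → thetaOn β m (L ++ X) ≡
  (+ (2 ^ length β)) when
    ((does (isComposition? m β) ∧ does (coverCond? L (I β))) ∧ does (coverCond? X (I β)))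
thetaOn-++ β m L X = cong ((+ (2 ^ length β)) when_)
  (trans (cong (does (isComposition? m β) ∧_) (coverCond?-++ L X (I β)))
         (sym (∧-assoc (does (isComposition? m β)) _ _)))

thetaOn-inclusion-exclusion : ∀ β m L q R →
  thetaOn β m (L ++ suc q ∷ R) ≡
    (thetaOn β m (L ++ q ∷ suc q ∷ R) +ℤ thetaOn β m (L ++ suc q ∷ suc (suc q) ∷ R))
      -ℤ thetaOn β m (L ++ q ∷ suc q ∷ suc (suc q) ∷ R)
thetaOn-inclusion-exclusion β m L q R =
  trans (thetaOn-++ β m L _)
    (trans (when-inclusion-exclusion (+ (2 ^ length β)) g (covers q) (covers (suc q))
              (covers (suc (suc q))) (does (coverCond? R (I β)))
              (does-true-⊎ (covers? (I β) (suc q)) (covers? (I β) q) (covers? (I β) (suc (suc q)))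
                (covers-suc⇒covers-neighbour q)))
      (sym (cong₂ _-ℤ_ (cong₂ _+ℤ_ (thetaOn-++ β m L _) (thetaOn-++ β m L _))
                       (thetaOn-++ β m L _))))
  where
  g : Bool
  g = does (isComposition? m β) ∧ does (coverCond? L (I β))
  covers : ℕ → Bool
  covers i = does (covers? (I β) i)

runningSums : ℕ → List ℕ → List ℕ
runningSums acc []       = []
runningSums acc (x ∷ xs) = acc + x ∷ runningSums (acc + x) xs

partialSums-cong : ∀ {acc acc′ x x′} r → acc + x ≡ acc′ + x′ →
  partialSums acc (x ∷ r) ≡ partialSums acc′ (x′ ∷ r)
partialSums-cong []      e = refl
partialSums-cong (y ∷ r) e = cong (λ t → t ∷ partialSums t (y ∷ r)) e

partialSums-suc : ∀ acc x r → partialSums acc (suc x ∷ r) ≡ partialSums (suc acc) (x ∷ r)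
partialSums-suc acc x r = partialSums-cong r (+-suc acc x)

partialSums-1∷ : ∀ acc y r →
  partialSums acc (1 ∷ y ∷ r) ≡ suc acc ∷ partialSums acc (suc y ∷ r)
partialSums-1∷ acc y r = cong₂ _∷_ (+-comm acc 1) (partialSums-cong r (+-assoc acc 1 y))

partialSums-∷-++ : ∀ acc x xs y r →
  partialSums acc (x ∷ xs ++ y ∷ r) ≡ acc + x ∷ partialSums (acc + x) (xs ++ y ∷ r)
partialSums-∷-++ acc x []      y r = refl
partialSums-∷-++ acc x (_ ∷ _) y r = refl

partialSums-++ : ∀ acc xs y r →
  partialSums acc (xs ++ y ∷ r) ≡ runningSums acc xs ++ partialSums (acc + sum xs) (y ∷ r)
partialSums-++ acc []       y r = partialSums-cong r (cong (_+ y) (sym (+-identityʳ acc)))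
partialSums-++ acc (x ∷ xs) y r = trans (partialSums-∷-++ acc x xs y r)
  (cong (acc + x ∷_) (trans (partialSums-++ (acc + x) xs y r)
    (cong (λ t → runningSums (acc + x) xs ++ partialSums t (y ∷ r)) (+-assoc acc x (sum xs)))))

thetaCoeff-refine-peak : ∀ pre a′ b′ post β →
  thetaCoeff (pre ++ suc a′ ∷ suc b′ ∷ post) β ≡
    (thetaCoeff (pre ++ a′ ∷ 1 ∷ suc b′ ∷ post) β
      +ℤ thetaCoeff (pre ++ suc a′ ∷ 1 ∷ b′ ∷ post) β)
      -ℤ thetaCoeff (pre ++ a′ ∷ 1 ∷ 1 ∷ b′ ∷ post) β
thetaCoeff-refine-peak pre a′ b′ post β = begin
  thetaOn β m (I (pre ++ suc a′ ∷ suc b′ ∷ post))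
    ≡⟨ cong (thetaOn β m) (I-split cuts₀) ⟩
  thetaOn β m (L ++ suc q ∷ R)
    ≡⟨ thetaOn-inclusion-exclusion β m L q R ⟩
  (thetaOn β m (L ++ q ∷ suc q ∷ R) +ℤ thetaOn β m (L ++ suc q ∷ suc (suc q) ∷ R))
    -ℤ thetaOn β m (L ++ q ∷ suc q ∷ suc (suc q) ∷ R)
    ≡⟨ sym (cong₂ _-ℤ_
         (cong₂ _+ℤ_ (cong₂ (thetaOn β) (same-size (+-suc a′ _)) (I-split cuts₁))
                     (cong₂ (thetaOn β) (same-size refl) (I-split cuts₂)))
         (cong₂ (thetaOn β) (same-size (+-suc a′ _)) (I-split cuts₃))) ⟩
  (thetaCoeff (pre ++ a′ ∷ 1 ∷ suc b′ ∷ post) β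
    +ℤ thetaCoeff (pre ++ suc a′ ∷ 1 ∷ b′ ∷ post) β)
    -ℤ thetaCoeff (pre ++ a′ ∷ 1 ∷ 1 ∷ b′ ∷ post) β ∎
  where
  open ≡-Reasoning
  s m q : ℕ
  s = sum pre
  m = sum (pre ++ suc a′ ∷ suc b′ ∷ post)
  q = s + a′
  L R : List ℕ
  L = runningSums 0 pre
  R = partialSums (suc q) (suc b′ ∷ post)

  same-size : ∀ {xs} → sum xs ≡ sum (suc a′ ∷ suc b′ ∷ post) → sum (pre ++ xs) ≡ m
  same-size {xs} e = trans (sum-++ pre xs) (trans (cong (λ t → s + t) e) (sym (sum-++ pre _)))

  I-split : ∀ {y r X} → partialSums s (y ∷ r) ≡ X → I (pre ++ y ∷ r) ≡ L ++ X
  I-split {y} {r} e = trans (partialSums-++ 0 pre y r) (cong (L ++_) e)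

  cuts₀ : partialSums s (suc a′ ∷ suc b′ ∷ post) ≡ suc q ∷ R
  cuts₀ = cong (λ t → t ∷ partialSums t (suc b′ ∷ post)) (+-suc s a′)

  cuts₁ : partialSums s (a′ ∷ 1 ∷ suc b′ ∷ post) ≡ q ∷ suc q ∷ R
  cuts₁ = cong (q ∷_) (trans (partialSums-1∷ q (suc b′) post)
                             (cong (suc q ∷_) (partialSums-suc q (suc b′) post)))

  cuts₂ : partialSums s (suc a′ ∷ 1 ∷ b′ ∷ post) ≡ suc q ∷ suc (suc q) ∷ R
  cuts₂ = trans (cong (s + suc a′ ∷_) (partialSums-1∷ (s + suc a′) b′ post))
                (cong (λ t → t ∷ suc t ∷ partialSums t (suc b′ ∷ post)) (+-suc s a′))

  cuts₃ : partialSums s (a′ ∷ 1 ∷ 1 ∷ b′ ∷ post) ≡ q ∷ suc q ∷ suc (suc q) ∷ R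
  cuts₃ = cong (q ∷_) (begin
    partialSums q (1 ∷ 1 ∷ b′ ∷ post)            ≡⟨ partialSums-1∷ q 1 (b′ ∷ post) ⟩
    suc q ∷ partialSums q (2 ∷ b′ ∷ post)        ≡⟨ cong (suc q ∷_) (partialSums-suc q 1 (b′ ∷ post)) ⟩
    suc q ∷ partialSums (suc q) (1 ∷ b′ ∷ post)  ≡⟨ cong (suc q ∷_) (partialSums-1∷ (suc q) b′ post) ⟩
    suc q ∷ suc (suc q) ∷ R                      ∎)

lemma4p5 : (n : ℕ) (α : List ℕ) → IsComposition n α →
    (n ≤ 1 ⊎ ∃[ a₁ ] ∃[ rest ] (α ≡ a₁ ∷ rest × 1 < a₁)) →
    (pre : List ℕ) (a b : ℕ) (post : List ℕ) → α ≡ pre ++ a ∷ b ∷ post →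
    InternalPeak n (I α) (sum pre + a) →
    (β : List ℕ) →
    thetaCoeff α β ≡
    (thetaCoeff (pre ++ (a ∸ 1) ∷ 1 ∷ b ∷ post) β
    +ℤ thetaCoeff (pre ++ a ∷ 1 ∷ (b ∸ 1) ∷ post) β)
    -ℤ thetaCoeff (pre ++ (a ∸ 1) ∷ 1 ∷ 1 ∷ (b ∸ 1) ∷ post) β
lemma4p5 n α (positive , _) _ pre a b post refl _ β with ++⁻ʳ pre positive
... | s≤s z≤n ∷ s≤s z≤n ∷ _ = thetaCoeff-refine-peak pre _ _ post β
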